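{- Let $G=(V,E)$ be a $\delta$-regular equatorial graph with girth $4$ and equator $q$. Then $q\equiv 0\pmod 4$ or $\delta\equiv 0\pmod 2$. Moreover, $V$ can be partitioned into $q$ independent sets $L_0,\dots,L_{q-1}$ such that $E$ consists exactly of all edges $uv$ with $u\in L_i$, $v\in L_{i+1}$ (indices mod $q$). Furthermore: if $q\equiv0\pmod4$, there are positive integers $n_0,n_1,n_2,n_3$ with $n_0+n_2=\delta=n_1+n_3$ and $|L_i|=n_j$ whenever $i\equiv j\pmod 4$; if $q\not\equiv0\pmod4$, then $|L_i|=\frac{\delta}{2}$ for all $i$.
   Context: A cycle $C$ in $G$ is isometric if $d_C(x,y)=d_G(x,y)$ for all $x,y\in V(C)$; the equator is the length of a longest isometric cycle. For $\delta\ge2$, $g\ge3$, $k=\lceil g/2\rceil-1$, the Moore bound is $M(\delta,g)=1+\sum_{i=0}^{k-1}\delta(\delta-1)^i$ for odd $g$ and $M(\delta,g)=2+\sum_{i=1}^{k}2(\delta-1)^i$ for even $g$ (so $M(\delta,4)=2\delta$). An equatorial graph is a finite graph with girth $g$, minimum degree $\delta$ and equator $q>6k+3$ whose order is exactly $\frac{q}{g}M(\delta,g)$; for $g=4$ this means $q>9$ and order $\frac{q\delta}{2}$. -}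

module Defs where

open import Data.Nat using (ℕ; zero; suc; _+_; _*_; _∸_; _^_; _≤_; _<_; _⊓_; ∣_-_∣; _/_; _%_)
open import Data.Fin using (Fin; toℕ) renaming (zero to fzero; suc to fsuc)
open import Data.Bool using (Bool; true; false; if_then_else_)
open import Data.Product using (Σ; ∃; _×_; _,_)
open import Data.Sum using (_⊎_)
open import Function.Definitions using (Injective)
open import Relation.Binary.PropositionalEquality using (_≡_)
open import Data.Fin using (_≟_)
open import Relation.Nullary.Decidable using (⌊_⌋)

record Graph : Set where
  field
    n      : ℕ
    adj    : Fin n → Fin n → Bool
    sym    : ∀ u v → adj u v ≡ adj v u
    irrefl : ∀ v → adj v v ≡ false
open Graph public

count : ∀ {m} → (Fin m → Bool) → ℕ
count {zero}  f = 0
count {suc m} f = (if f fzero then 1 else 0) + count (λ i → f (fsuc i))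

degree : (G : Graph) → Fin (n G) → ℕ
degree G v = count (adj G v)

Regular : Graph → ℕ → Set
Regular G δ = ∀ v → degree G v ≡ δ

MinDegree : Graph → ℕ → Set
MinDegree G δ = (∀ v → δ ≤ degree G v) × (∃ λ v → degree G v ≡ δ)

CycSucc : ∀ {q} → Fin q → Fin q → Set
CycSucc {q} i j = (toℕ j ≡ suc (toℕ i)) ⊎ ((suc (toℕ i) ≡ q) × (toℕ j ≡ 0))

data Walk (G : Graph) : Fin (n G) → Fin (n G) → ℕ → Set where
  nil  : ∀ {x} → Walk G x x 0
  cons : ∀ {x y z k} → adj G x y ≡ true → Walk G y z k → Walk G x z (suc k)

Dist : (G : Graph) → Fin (n G) → Fin (n G) → ℕ → Set
Dist G x y d = Walk G x y d × (∀ m → Walk G x y m → d ≤ m)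

record Cycle (G : Graph) (ℓ : ℕ) : Set where
  field
    len≥3 : 3 ≤ ℓ
    vert  : Fin ℓ → Fin (n G)
    inj   : Injective _≡_ _≡_ vert
    edges : ∀ i j → CycSucc i j → adj G (vert i) (vert j) ≡ true
open Cycle public

cycDist : ∀ {ℓ} → Fin ℓ → Fin ℓ → ℕ
cycDist {ℓ} i j = ∣ toℕ i - toℕ j ∣ ⊓ (ℓ ∸ ∣ toℕ i - toℕ j ∣)

Isometric : (G : Graph) {ℓ : ℕ} → Cycle G ℓ → Set
Isometric G {ℓ} C = ∀ (i j : Fin ℓ) → Dist G (vert C i) (vert C j) (cycDist i j)

Girth : Graph → ℕ → Set
Girth G g = Cycle G g × (∀ ℓ → Cycle G ℓ → g ≤ ℓ)

Equator : Graph → ℕ → Set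
Equator G q = (Σ (Cycle G q) (Isometric G)) × (∀ ℓ (C : Cycle G ℓ) → Isometric G C → ℓ ≤ q)

-- k = ⌈g/2⌉ - 1
kOf : ℕ → ℕ
kOf g = (g + 1) / 2 ∸ 1

sumFrom : ℕ → ℕ → (ℕ → ℕ) → ℕ
sumFrom a zero    f = 0
sumFrom a (suc m) f = f a + sumFrom (suc a) m f

Moore : ℕ → ℕ → ℕ
Moore δ g with g % 2
... | 0 = 2 + sumFrom 1 (kOf g) (λ i → 2 * (δ ∸ 1) ^ i)
... | _ = 1 + sumFrom 0 (kOf g) (λ i → δ * (δ ∸ 1) ^ i)

-- equatorial graph with minimum degree δ, girth g, equator q:
-- order = (q/g)·M(δ,g), written multiplicatively as order·g = q·M(δ,g)
Equatorial : Graph → ℕ → ℕ → ℕ → Set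
Equatorial G δ g q =
  (2 ≤ δ) × (3 ≤ g) × Girth G g × MinDegree G δ × Equator G q ×
  (6 * kOf g + 3 < q) × (n G * g ≡ q * Moore δ g)

layerSize : (G : Graph) {q : ℕ} → (Fin (n G) → Fin q) → Fin q → ℕ
layerSize G L i = count (λ v → ⌊ L v ≟ i ⌋)

-- Girth 4 rules out triangles, and the order condition reads 2n = qδ. Let C be an
-- isometric q-cycle, q ≥ 10. Two neighbours of a vertex v on C are at distance 2 in G,
-- hence (no triangles) exactly two apart on C, and q ≥ 10 leaves room for at most two
-- of them. Counting the edges between V and C, qδ = 2n forces exactly two, c a and
-- c (a + 2); label v by a. Isometry makes the labels of adjacent vertices consecutive,
-- so the neighbourhood of a vertex labelled i + 1 lies in L i ∪ L (i + 2). Counting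
-- once more, |L i| + |L (i + 2)| = δ for all i, which makes that inclusion an equality.
-- The layer sizes thus form a sequence ν with ν (k + 2) + ν k = δ, of period 4 and of
-- period q; when 4 ∤ q it has period 2, i.e. every layer has δ / 2 vertices.

module Submission where

open import Defs renaming (sym to adj-sym)
open import Data.Bool using (Bool; true; false; if_then_else_; _∧_; _∨_; not)
open import Data.Bool.Properties using (∧-identityʳ)
open import Data.Empty using (⊥; ⊥-elim)
open import Data.Fin using (Fin; zero; suc; toℕ; #_; _≟_)
open import Data.Fin.Permutation using (permutation)
open import Data.Fin.Properties using (suc-injective; toℕ-injective; toℕ<n; toℕ-fromℕ<)
open import Data.Nat
  using (ℕ; zero; suc; _+_; _*_; _∸_; _/_; _%_; _⊓_; _≤_; _<_; z≤n; s≤s; s≤s⁻¹;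
         NonZero; >-nonZero; >-nonZero⁻¹)
open import Data.Nat.DivMod
  using (_mod_; m%n<n; m≡m%n+[m/n]*n; %-distribˡ-+; m%n%n≡m%n; m<n⇒m%n≡m; [m+n]%n≡m%n; n%n≡0)
open import Data.Nat.Divisibility using (_∣_; _∣?_; divides; m%n≡0⇒n∣m)
open import Data.Nat.Properties hiding (_≟_; suc-injective)
open import Algebra.Properties.CommutativeMonoid.Sum +-0-commutativeMonoid
  using (sum; sum-cong-≗; ∑-comm; ∑-distrib-+; sum-permute)
open import Data.Product using (∃; ∃₂; _×_; _,_; proj₁; proj₂)
open import Data.Sum using (_⊎_; inj₁; inj₂; swap)
import Data.Sum as Sum
open import Data.Vec using (Vec; lookup; tabulate)
open import Data.Vec.Properties using (lookup∘tabulate)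
open import Function using (_∘_)
open import Function.Bundles using (_⇔_; mk⇔)
open import Relation.Nullary using (¬_; yes; no)
open import Relation.Nullary.Decidable using (Dec; ⌊_⌋; ⌊⌋-map′)
open import Relation.Binary.PropositionalEquality
  using (_≡_; _≢_; refl; sym; trans; cong; cong₂; subst; subst₂; module ≡-Reasoning)

∑-const : ∀ m c → sum {m} (λ _ → c) ≡ m * c
∑-const zero    c = refl
∑-const (suc m) c = cong (c +_) (∑-const m c)

∑-mono-≤ : ∀ {m} {f g : Fin m → ℕ} → (∀ i → f i ≤ g i) → sum f ≤ sum g
∑-mono-≤ {zero}  f≤g = z≤n
∑-mono-≤ {suc m} f≤g = +-mono-≤ (f≤g zero) (∑-mono-≤ (f≤g ∘ suc))

∑-mono-≤-tight : ∀ {m} {f g : Fin m → ℕ} → (∀ i → f i ≤ g i) → sum g ≤ sum f → ∀ i → f i ≡ g i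
∑-mono-≤-tight {suc m} {f} {g} f≤g Σg≤Σf = λ where
    zero    → ≤-antisym (f≤g zero) (+-cancelʳ-≤ _ _ _ (≤-trans Σg≤Σf (+-monoʳ-≤ (f zero) tail-≤)))
    (suc i) → ∑-mono-≤-tight (f≤g ∘ suc) (+-cancelˡ-≤ _ _ _ (≤-trans Σg≤Σf (+-monoˡ-≤ _ (f≤g zero)))) i
  where
  tail-≤ : sum (f ∘ suc) ≤ sum (g ∘ suc)
  tail-≤ = ∑-mono-≤ (f≤g ∘ suc)

⌊⌋-complete : ∀ {A : Set} (a? : Dec A) → A → ⌊ a? ⌋ ≡ true
⌊⌋-complete (yes _) _ = refl
⌊⌋-complete (no ¬a) a = ⊥-elim (¬a a)

⌊⌋-∨-intro : ∀ {A B : Set} (a? : Dec A) (b? : Dec B) → A ⊎ B → ⌊ a? ⌋ ∨ ⌊ b? ⌋ ≡ true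
⌊⌋-∨-intro (yes _) _       _        = refl
⌊⌋-∨-intro (no _)  (yes _) _        = refl
⌊⌋-∨-intro (no ¬a) (no _)  (inj₁ a) = ⊥-elim (¬a a)
⌊⌋-∨-intro (no _)  (no ¬b) (inj₂ b) = ⊥-elim (¬b b)

indicator : Bool → ℕ
indicator b = if b then 1 else 0

count≡∑ : ∀ {m} (f : Fin m → Bool) → count f ≡ sum (indicator ∘ f)
count≡∑ {zero}  f = refl
count≡∑ {suc m} f = cong (indicator (f zero) +_) (count≡∑ (f ∘ suc))

count-cong : ∀ {m} {f g : Fin m → Bool} → (∀ i → f i ≡ g i) → count f ≡ count g
count-cong {zero}  f≗g = refl
count-cong {suc m} f≗g = cong₂ _+_ (cong indicator (f≗g zero)) (count-cong (f≗g ∘ suc))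

_⊆_ : ∀ {m} → (Fin m → Bool) → (Fin m → Bool) → Set
f ⊆ g = ∀ i → f i ≡ true → g i ≡ true

indicator-mono : ∀ {a b} → (a ≡ true → b ≡ true) → indicator a ≤ indicator b
indicator-mono {false} a⇒b = z≤n
indicator-mono {true}  a⇒b rewrite a⇒b refl = ≤-refl

indicator-injective : ∀ {a b} → indicator a ≡ indicator b → a ≡ b
indicator-injective {false} {false} _ = refl
indicator-injective {true}  {true}  _ = refl

count-mono : ∀ {m} {f g : Fin m → Bool} → f ⊆ g → count f ≤ count g
count-mono {f = f} {g} f⊆g =
  subst₂ _≤_ (sym (count≡∑ f)) (sym (count≡∑ g)) (∑-mono-≤ (λ i → indicator-mono (f⊆g i)))

count-mono-tight : ∀ {m} {f g : Fin m → Bool} → f ⊆ g → count g ≤ count f → g ⊆ f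
count-mono-tight {f = f} {g} f⊆g #g≤#f i gi =
  trans (indicator-injective (∑-mono-≤-tight (λ j → indicator-mono (f⊆g j))
                                (subst₂ _≤_ (count≡∑ g) (count≡∑ f) #g≤#f) i)) gi

count-∨ : ∀ {m} (f g : Fin m → Bool) → count (λ i → f i ∨ g i) ≤ count f + count g
count-∨ f g = begin
  count (λ i → f i ∨ g i)                        ≡⟨ count≡∑ (λ i → f i ∨ g i) ⟩
  sum (λ i → indicator (f i ∨ g i))              ≤⟨ ∑-mono-≤ (λ i → indicator-∨ (f i) (g i)) ⟩
  sum (λ i → indicator (f i) + indicator (g i))  ≡⟨ ∑-distrib-+ (indicator ∘ f) (indicator ∘ g) ⟩
  sum (indicator ∘ f) + sum (indicator ∘ g)      ≡⟨ cong₂ _+_ (count≡∑ f) (count≡∑ g) ⟨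
  count f + count g                              ∎
  where
  open ≤-Reasoning
  indicator-∨ : ∀ a b → indicator (a ∨ b) ≤ indicator a + indicator b
  indicator-∨ true  b = s≤s z≤n
  indicator-∨ false b = ≤-refl

count-≟ : ∀ {m} (x : Fin m) → count (λ i → ⌊ x ≟ i ⌋) ≡ 1
count-≟ {suc m} zero    = cong suc (trans (count≡∑ {m} (λ _ → false)) (trans (∑-const m 0) (*-zeroʳ m)))
count-≟ {suc m} (suc x) =
  trans (count-cong (λ i → ⌊⌋-map′ (cong suc) suc-injective (x ≟ i))) (count-≟ x)

count-∑-comm : ∀ {m k} (F : Fin m → Fin k → Bool) →
  sum (λ i → count (F i)) ≡ sum (λ j → count (λ i → F i j))
count-∑-comm F = begin
  sum (λ i → count (F i))                    ≡⟨ sum-cong-≗ (λ i → count≡∑ (F i)) ⟩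
  sum (λ i → sum (λ j → indicator (F i j)))  ≡⟨ ∑-comm (λ i j → indicator (F i j)) ⟩
  sum (λ j → sum (λ i → indicator (F i j)))  ≡⟨ sum-cong-≗ (λ j → count≡∑ (λ i → F i j)) ⟨
  sum (λ j → count (λ i → F i j))            ∎
  where open ≡-Reasoning

∑-count-fibres : ∀ {m k} (f : Fin m → Fin k) → sum (λ i → count (λ x → ⌊ f x ≟ i ⌋)) ≡ m
∑-count-fibres {m} f = begin
  sum (λ i → count (λ x → ⌊ f x ≟ i ⌋))  ≡⟨ count-∑-comm (λ i x → ⌊ f x ≟ i ⌋) ⟩
  sum (λ x → count (λ i → ⌊ f x ≟ i ⌋))  ≡⟨ sum-cong-≗ (λ x → count-≟ (f x)) ⟩
  sum {m} (λ _ → 1)                      ≡⟨ ∑-const m 1 ⟩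
  m * 1                                  ≡⟨ *-identityʳ m ⟩
  m                                      ∎
  where open ≡-Reasoning

count-witness : ∀ {m} (f : Fin m → Bool) → 0 < count f → ∃ λ i → f i ≡ true
count-witness {suc m} f #f>0 with f zero in f₀
... | true  = zero , f₀
... | false = let i , fi = count-witness (f ∘ suc) #f>0 in suc i , fi

_∖_ : ∀ {m} → (Fin m → Bool) → Fin m → Fin m → Bool
(f ∖ a) i = f i ∧ not ⌊ a ≟ i ⌋

∖-true : ∀ {m} (f : Fin m → Bool) a i → (f ∖ a) i ≡ true → f i ≡ true × a ≢ i
∖-true f a i f∖a with f i | a ≟ i
... | true | no a≢i = refl , a≢i

count-∖ : ∀ {m} (f : Fin m → Bool) a → f a ≡ true → count f ≡ suc (count (f ∖ a))
count-∖ f a fa = begin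
  count f                                          ≡⟨ count≡∑ f ⟩
  sum (indicator ∘ f)                              ≡⟨ sum-cong-≗ split ⟩
  sum (λ i → indicator ((f ∖ a) i) + indicator ⌊ a ≟ i ⌋)
    ≡⟨ ∑-distrib-+ (indicator ∘ (f ∖ a)) (λ i → indicator ⌊ a ≟ i ⌋) ⟩
  sum (indicator ∘ (f ∖ a)) + sum (λ i → indicator ⌊ a ≟ i ⌋)
    ≡⟨ cong₂ _+_ (count≡∑ (f ∖ a)) (count≡∑ (λ i → ⌊ a ≟ i ⌋)) ⟨
  count (f ∖ a) + count (λ i → ⌊ a ≟ i ⌋)          ≡⟨ cong (count (f ∖ a) +_) (count-≟ a) ⟩
  count (f ∖ a) + 1                                ≡⟨ +-comm (count (f ∖ a)) 1 ⟩
  suc (count (f ∖ a))                              ∎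
  where
  open ≡-Reasoning
  split : ∀ i → indicator (f i) ≡ indicator ((f ∖ a) i) + indicator ⌊ a ≟ i ⌋
  split i with a ≟ i
  ... | yes refl rewrite fa = refl
  ... | no _ = trans (cong indicator (sym (∧-identityʳ (f i)))) (sym (+-identityʳ _))

count-pos : ∀ {m} (f : Fin m → Bool) {a} → f a ≡ true → 0 < count f
count-pos f {a} fa = subst (0 <_) (sym (count-∖ f a fa)) (s≤s z≤n)

distinct-pair : ∀ {m} (f : Fin m → Bool) → 2 ≤ count f →
  ∃₂ λ a b → a ≢ b × f a ≡ true × f b ≡ true
distinct-pair f #f≥2 =
  let a , fa = count-witness f (≤-trans (s≤s z≤n) #f≥2)
      b , f∖a = count-witness (f ∖ a) (s≤s⁻¹ (subst (2 ≤_) (count-∖ f a fa) #f≥2))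
      fb , a≢b = ∖-true f a b f∖a
  in a , b , a≢b , fa , fb

count-⊆-pair : ∀ {m} (f : Fin m → Bool) a b → (∀ i → f i ≡ true → i ≡ a ⊎ i ≡ b) → count f ≤ 2
count-⊆-pair f a b f⊆ab = begin
  count f                                            ≤⟨ count-mono f⊆[a,b] ⟩
  count (λ i → ⌊ a ≟ i ⌋ ∨ ⌊ b ≟ i ⌋)                ≤⟨ count-∨ (λ i → ⌊ a ≟ i ⌋) (λ i → ⌊ b ≟ i ⌋) ⟩
  count (λ i → ⌊ a ≟ i ⌋) + count (λ i → ⌊ b ≟ i ⌋)  ≡⟨ cong₂ _+_ (count-≟ a) (count-≟ b) ⟩
  2                                                  ∎
  where
  open ≤-Reasoning
  f⊆[a,b] : f ⊆ (λ i → ⌊ a ≟ i ⌋ ∨ ⌊ b ≟ i ⌋)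
  f⊆[a,b] i fi = ⌊⌋-∨-intro (a ≟ i) (b ≟ i) (Sum.map sym sym (f⊆ab i fi))

module Cyclic (q : ℕ) .{{_ : NonZero q}} where

  infixl 6 _⊕_
  _⊕_ : Fin q → ℕ → Fin q
  i ⊕ t = (toℕ i + t) mod q

  toℕ-⊕ : ∀ i t → toℕ (i ⊕ t) ≡ (toℕ i + t) % q
  toℕ-⊕ i t = toℕ-fromℕ< (m%n<n (toℕ i + t) q)

  [m%q+t]%q≡[m+t]%q : ∀ m t → (m % q + t) % q ≡ (m + t) % q
  [m%q+t]%q≡[m+t]%q m t = begin
    (m % q + t) % q          ≡⟨ %-distribˡ-+ (m % q) t q ⟩
    (m % q % q + t % q) % q  ≡⟨ cong (λ x → (x + t % q) % q) (m%n%n≡m%n m q) ⟩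
    (m % q + t % q) % q      ≡⟨ %-distribˡ-+ m t q ⟨
    (m + t) % q              ∎
    where open ≡-Reasoning

  ⊕-no-wrap : ∀ i t {j} → toℕ i + t ≡ toℕ j → i ⊕ t ≡ j
  ⊕-no-wrap i t {j} e = toℕ-injective (begin
    toℕ (i ⊕ t)      ≡⟨ toℕ-⊕ i t ⟩
    (toℕ i + t) % q  ≡⟨ cong (_% q) e ⟩
    toℕ j % q        ≡⟨ m<n⇒m%n≡m (toℕ<n j) ⟩
    toℕ j            ∎)
    where open ≡-Reasoning

  ⊕-wrap : ∀ i t {j} → toℕ i + t ≡ toℕ j + q → i ⊕ t ≡ j
  ⊕-wrap i t {j} e = toℕ-injective (begin
    toℕ (i ⊕ t)      ≡⟨ toℕ-⊕ i t ⟩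
    (toℕ i + t) % q  ≡⟨ cong (_% q) e ⟩
    (toℕ j + q) % q  ≡⟨ [m+n]%n≡m%n (toℕ j) q ⟩
    toℕ j % q        ≡⟨ m<n⇒m%n≡m (toℕ<n j) ⟩
    toℕ j            ∎)
    where open ≡-Reasoning

  ⊕-assoc : ∀ i s t → i ⊕ s ⊕ t ≡ i ⊕ (s + t)
  ⊕-assoc i s t = toℕ-injective (begin
    toℕ (i ⊕ s ⊕ t)            ≡⟨ toℕ-⊕ (i ⊕ s) t ⟩
    (toℕ (i ⊕ s) + t) % q      ≡⟨ cong (λ x → (x + t) % q) (toℕ-⊕ i s) ⟩
    ((toℕ i + s) % q + t) % q  ≡⟨ [m%q+t]%q≡[m+t]%q (toℕ i + s) t ⟩
    (toℕ i + s + t) % q        ≡⟨ cong (_% q) (+-assoc (toℕ i) s t) ⟩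
    (toℕ i + (s + t)) % q      ≡⟨ toℕ-⊕ i (s + t) ⟨
    toℕ (i ⊕ (s + t))          ∎)
    where open ≡-Reasoning

  ⊕-identityʳ : ∀ i → i ⊕ 0 ≡ i
  ⊕-identityʳ i = ⊕-no-wrap i 0 (+-identityʳ (toℕ i))

  ⊕-q : ∀ i → i ⊕ q ≡ i
  ⊕-q i = ⊕-wrap i q refl

  ⊕-∸-inverseʳ : ∀ {t} i → t ≤ q → i ⊕ t ⊕ (q ∸ t) ≡ i
  ⊕-∸-inverseʳ {t} i t≤q = trans (⊕-assoc i t (q ∸ t)) (trans (cong (i ⊕_) (m+[n∸m]≡n t≤q)) (⊕-q i))

  ⊕-∸-inverseˡ : ∀ {t} i → t ≤ q → i ⊕ (q ∸ t) ⊕ t ≡ i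
  ⊕-∸-inverseˡ {t} i t≤q = trans (⊕-assoc i (q ∸ t) t) (trans (cong (i ⊕_) (m∸n+n≡m t≤q)) (⊕-q i))

  ⊕-cancelʳ : ∀ {i j t} → t ≤ q → i ⊕ t ≡ j ⊕ t → i ≡ j
  ⊕-cancelʳ {i} {j} {t} t≤q e =
    trans (sym (⊕-∸-inverseʳ i t≤q)) (trans (cong (_⊕ (q ∸ t)) e) (⊕-∸-inverseʳ j t≤q))

  ⊕-aperiodic : ∀ {i t} → 0 < t → t < q → i ⊕ t ≢ i
  ⊕-aperiodic {i} {t} 0<t t<q i⊕t≡i = multiple-of-q {k} (+-cancelˡ-≡ (toℕ i) t (k * q) (begin
    toℕ i + t                ≡⟨ m≡m%n+[m/n]*n (toℕ i + t) q ⟩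
    (toℕ i + t) % q + k * q  ≡⟨ cong (_+ k * q) (trans (sym (toℕ-⊕ i t)) (cong toℕ i⊕t≡i)) ⟩
    toℕ i + k * q            ∎))
    where
    open ≡-Reasoning
    k = (toℕ i + t) / q
    multiple-of-q : ∀ {k} → t ≡ k * q → ⊥
    multiple-of-q {zero}  t≡0   = <⇒≢ 0<t (sym t≡0)
    multiple-of-q {suc k} t≡kq = <⇒≱ t<q (subst (q ≤_) (sym t≡kq) (m≤m+n q (k * q)))

  ⊕-distinct : ∀ {i s t} → s < t → t < q → i ⊕ s ≢ i ⊕ t
  ⊕-distinct {i} {s} {t} s<t t<q i⊕s≡i⊕t =
    ⊕-aperiodic (m<n⇒0<n∸m s<t) (≤-<-trans (m∸n≤m t s) t<q) (begin
    i ⊕ s ⊕ (t ∸ s)    ≡⟨ ⊕-assoc i s (t ∸ s) ⟩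
    i ⊕ (s + (t ∸ s))  ≡⟨ cong (i ⊕_) (m+[n∸m]≡n (<⇒≤ s<t)) ⟩
    i ⊕ t              ≡⟨ i⊕s≡i⊕t ⟨
    i ⊕ s              ∎)
    where open ≡-Reasoning

  CycSucc⇒⊕1 : ∀ {i j} → CycSucc i j → j ≡ i ⊕ 1
  CycSucc⇒⊕1 {i} (inj₁ j≡1+i) = sym (⊕-no-wrap i 1 (trans (+-comm (toℕ i) 1) (sym j≡1+i)))
  CycSucc⇒⊕1 {i} (inj₂ (1+i≡q , j≡0)) =
    sym (⊕-wrap i 1 (trans (+-comm (toℕ i) 1) (trans 1+i≡q (cong (_+ q) (sym j≡0)))))

  CycSucc-⊕1 : ∀ i → CycSucc i (i ⊕ 1)
  CycSucc-⊕1 i with m≤n⇒m<n∨m≡n (toℕ<n i)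
  ... | inj₁ 1+i<q = inj₁ (trans (toℕ-⊕ i 1)
          (trans (m<n⇒m%n≡m (subst (_< q) (+-comm 1 (toℕ i)) 1+i<q)) (+-comm (toℕ i) 1)))
  ... | inj₂ 1+i≡q = inj₂ (1+i≡q , trans (toℕ-⊕ i 1)
          (trans (cong (_% q) (trans (+-comm (toℕ i) 1) 1+i≡q)) (n%n≡0 q)))

  ⊕1⇒CycSucc : ∀ {i j} → j ≡ i ⊕ 1 → CycSucc i j
  ⊕1⇒CycSucc {i} j≡i⊕1 = subst (CycSucc i) (sym j≡i⊕1) (CycSucc-⊕1 i)

  short-arc : ∀ {a b d D} → toℕ a + D ≡ toℕ b → D ⊓ (q ∸ D) ≤ d →
              ∃ λ t → t ≤ d × (b ≡ a ⊕ t ⊎ a ≡ b ⊕ t)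
  short-arc {a} {b} {d} {D} a+D≡b min≤d with ⊓-sel D (q ∸ D)
  ... | inj₁ min≡D   = D , subst (_≤ d) min≡D min≤d , inj₁ (sym (⊕-no-wrap a D a+D≡b))
  ... | inj₂ min≡q∸D = q ∸ D , subst (_≤ d) min≡q∸D min≤d , inj₂ (sym (⊕-wrap b (q ∸ D) (begin
    toℕ b + (q ∸ D)        ≡⟨ cong (_+ (q ∸ D)) a+D≡b ⟨
    toℕ a + D + (q ∸ D)    ≡⟨ +-assoc (toℕ a) D (q ∸ D) ⟩
    toℕ a + (D + (q ∸ D))  ≡⟨ cong (toℕ a +_) (m+[n∸m]≡n D≤q) ⟩
    toℕ a + q              ∎)))
    where
    open ≡-Reasoning
    D≤q : D ≤ q
    D≤q = ≤-trans (m≤n+m D (toℕ a)) (≤-trans (≤-reflexive a+D≡b) (<⇒≤ (toℕ<n b)))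

  cycDist-offset : ∀ i j {d} → cycDist i j ≤ d → ∃ λ t → t ≤ d × (j ≡ i ⊕ t ⊎ i ≡ j ⊕ t)
  cycDist-offset i j {d} dist≤d with ≤-total (toℕ i) (toℕ j)
  ... | inj₁ i≤j = short-arc (m+[n∸m]≡n i≤j) (subst (λ D → D ⊓ (q ∸ D) ≤ d) (m≤n⇒∣m-n∣≡n∸m i≤j) dist≤d)
  ... | inj₂ j≤i =
    let t , t≤d , i≡j⊕t⊎j≡i⊕t = short-arc (m+[n∸m]≡n j≤i) (subst (λ D → D ⊓ (q ∸ D) ≤ d) (m≤n⇒∣n-m∣≡n∸m j≤i) dist≤d)
    in t , t≤d , swap i≡j⊕t⊎j≡i⊕t

  ∑-rotate : ∀ {t} (f : Fin q → ℕ) → t ≤ q → sum (λ i → f (i ⊕ t)) ≡ sum f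
  ∑-rotate {t} f t≤q =
    sym (sum-permute f (permutation (_⊕ t) (_⊕ (q ∸ t)) (λ i → ⊕-∸-inverseˡ i t≤q)
                                                         (λ i → ⊕-∸-inverseʳ i t≤q)))

  mod-⊕ : ∀ k t → k mod q ⊕ t ≡ (k + t) mod q
  mod-⊕ k t = toℕ-injective (begin
    toℕ (k mod q ⊕ t)          ≡⟨ toℕ-⊕ (k mod q) t ⟩
    (toℕ (k mod q) + t) % q    ≡⟨ cong (λ x → (x + t) % q) (toℕ-fromℕ< (m%n<n k q)) ⟩
    (k % q + t) % q            ≡⟨ [m%q+t]%q≡[m+t]%q k t ⟩
    (k + t) % q                ≡⟨ toℕ-fromℕ< (m%n<n (k + t) q) ⟨
    toℕ ((k + t) mod q)        ∎)
    where open ≡-Reasoning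

  consecutive-around : ∀ {i j k} → j ≡ i ⊕ 1 → k ≡ j ⊕ 1 ⊎ j ≡ k ⊕ 1 → k ≡ i ⊕ 2 ⊎ k ≡ i
  consecutive-around {i} j≡i⊕1 (inj₁ k≡j⊕1) =
    inj₁ (trans k≡j⊕1 (trans (cong (_⊕ 1) j≡i⊕1) (⊕-assoc i 1 1)))
  consecutive-around {i} j≡i⊕1 (inj₂ j≡k⊕1) =
    inj₂ (⊕-cancelʳ (>-nonZero⁻¹ q) (trans (sym j≡k⊕1) j≡i⊕1))

  toℕ-mod : ∀ i → toℕ i mod q ≡ i
  toℕ-mod i = toℕ-injective (trans (toℕ-fromℕ< (m%n<n (toℕ i) q)) (m<n⇒m%n≡m (toℕ<n i)))

Periodic : (ℕ → ℕ) → ℕ → Set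
Periodic ν p = ∀ k → ν (k + p) ≡ ν k

module _ {ν : ℕ → ℕ} where

  periodic-* : ∀ {p} → Periodic ν p → ∀ m → Periodic ν (m * p)
  periodic-* per zero    k = cong ν (+-identityʳ k)
  periodic-* {p} per (suc m) k = begin
    ν (k + (p + m * p))  ≡⟨ cong ν (+-assoc k p (m * p)) ⟨
    ν (k + p + m * p)    ≡⟨ periodic-* per m (k + p) ⟩
    ν (k + p)            ≡⟨ per k ⟩
    ν k                  ∎
    where open ≡-Reasoning

  periodic-% : ∀ {d p} .{{_ : NonZero d}} → Periodic ν d → Periodic ν p → Periodic ν (p % d)
  periodic-% {d} {p} per-d per-p k = begin
    ν (k + p % d)                ≡⟨ periodic-* per-d (p / d) (k + p % d) ⟨
    ν (k + p % d + p / d * d)    ≡⟨ cong ν (+-assoc k (p % d) (p / d * d)) ⟩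
    ν (k + (p % d + p / d * d))  ≡⟨ cong (λ x → ν (k + x)) (m≡m%n+[m/n]*n p d) ⟨
    ν (k + p)                    ≡⟨ per-p k ⟩
    ν k                          ∎
    where open ≡-Reasoning

module Alternating {ν : ℕ → ℕ} {δ : ℕ} (alternating : ∀ k → ν (k + 2) + ν k ≡ δ) where

  periodic-4 : Periodic ν 4
  periodic-4 k = +-cancelʳ-≡ (ν (k + 2)) (ν (k + 4)) (ν k) (begin
    ν (k + 4) + ν (k + 2)      ≡⟨ cong (λ x → ν x + ν (k + 2)) (+-assoc k 2 2) ⟨
    ν (k + 2 + 2) + ν (k + 2)  ≡⟨ alternating (k + 2) ⟩
    δ                          ≡⟨ alternating k ⟨
    ν (k + 2) + ν k            ≡⟨ +-comm (ν (k + 2)) (ν k) ⟩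
    ν k + ν (k + 2)            ∎)
    where open ≡-Reasoning

  ν≡ν[%4] : ∀ k → ν k ≡ ν (k % 4)
  ν≡ν[%4] k = begin
    ν k                    ≡⟨ cong ν (m≡m%n+[m/n]*n k 4) ⟩
    ν (k % 4 + k / 4 * 4)  ≡⟨ periodic-* periodic-4 (k / 4) (k % 4) ⟩
    ν (k % 4)              ∎
    where open ≡-Reasoning

  periodic-2⇒halves : Periodic ν 2 → ∀ k → 2 * ν k ≡ δ
  periodic-2⇒halves per₂ k = begin
    2 * ν k          ≡⟨ cong (ν k +_) (+-identityʳ (ν k)) ⟩
    ν k + ν k        ≡⟨ cong (_+ ν k) (per₂ k) ⟨
    ν (k + 2) + ν k  ≡⟨ alternating k ⟩
    δ                ∎
    where open ≡-Reasoning

  periodic-2-unless-4∣ : ∀ {p} → Periodic ν p → ¬ 4 ∣ p → Periodic ν 2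
  periodic-2-unless-4∣ {p} per-p 4∤p =
    from-residue (p % 4) (periodic-% periodic-4 per-p) (m%n<n p 4) (4∤p ∘ m%n≡0⇒n∣m p 4)
    where
    from-residue : ∀ r → Periodic ν r → r < 4 → r ≢ 0 → Periodic ν 2
    from-residue 0 _    _ r≢0 = ⊥-elim (r≢0 refl)
    from-residue 1 per₁ _ _   = periodic-* per₁ 2
    from-residue 2 per₂ _ _   = per₂
    from-residue 3 per₃ _ _   = periodic-* (periodic-% per₃ periodic-4) 2
    from-residue (suc (suc (suc (suc _)))) _ (s≤s (s≤s (s≤s (s≤s ())))) _

Moore-girth-4 : ∀ {δ} → 1 ≤ δ → Moore δ 4 ≡ 2 * δ
Moore-girth-4 {suc d} _ = begin
  2 + (2 * (d * 1) + 0)  ≡⟨ cong (2 +_) (+-identityʳ (2 * (d * 1))) ⟩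
  2 + 2 * (d * 1)        ≡⟨ cong (λ x → 2 + 2 * x) (*-identityʳ d) ⟩
  2 + 2 * d              ≡⟨ *-suc 2 d ⟨
  2 * suc d              ∎
  where open ≡-Reasoning

TriangleFree : Graph → Set
TriangleFree G = ∀ {x y z} → adj G x y ≡ true → adj G y z ≡ true → adj G x z ≡ true → ⊥

adj⇒≢ : ∀ (G : Graph) {x y} → adj G x y ≡ true → x ≢ y
adj⇒≢ G {x} x~y refl with trans (sym (irrefl G x)) x~y
... | ()

triangle-cycle : ∀ (G : Graph) {x y z} →
  adj G x y ≡ true → adj G y z ≡ true → adj G x z ≡ true → Cycle G 3
triangle-cycle G {x} {y} {z} x~y y~z x~z = record
  { len≥3 = ≤-refl
  ; vert  = corner
  ; inj   = corner-injective
  ; edges = λ i j i→j → subst (λ k → adj G (corner i) (corner k) ≡ true) (sym (CycSucc⇒⊕1 i→j)) (step i)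
  }
  where
  open Cyclic 3 using (_⊕_; CycSucc⇒⊕1)
  corner : Fin 3 → Fin (n G)
  corner zero             = x
  corner (suc zero)       = y
  corner (suc (suc zero)) = z
  step : ∀ i → adj G (corner i) (corner (i ⊕ 1)) ≡ true
  step zero             = x~y
  step (suc zero)       = y~z
  step (suc (suc zero)) = trans (adj-sym G z x) x~z
  corner-injective : ∀ {i j} → corner i ≡ corner j → i ≡ j
  corner-injective {zero}             {zero}             _ = refl
  corner-injective {zero}             {suc zero}         e = ⊥-elim (adj⇒≢ G x~y e)
  corner-injective {zero}             {suc (suc zero)}   e = ⊥-elim (adj⇒≢ G x~z e)
  corner-injective {suc zero}         {zero}             e = ⊥-elim (adj⇒≢ G x~y (sym e))
  corner-injective {suc zero}         {suc zero}         _ = refl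
  corner-injective {suc zero}         {suc (suc zero)}   e = ⊥-elim (adj⇒≢ G y~z e)
  corner-injective {suc (suc zero)}   {zero}             e = ⊥-elim (adj⇒≢ G x~z (sym e))
  corner-injective {suc (suc zero)}   {suc zero}         e = ⊥-elim (adj⇒≢ G y~z (sym e))
  corner-injective {suc (suc zero)}   {suc (suc zero)}   _ = refl

girth>3⇒triangleFree : ∀ {G g} → Girth G g → 3 < g → TriangleFree G
girth>3⇒triangleFree {G} (_ , shortest) 3<g x~y y~z x~z =
  <⇒≱ 3<g (shortest 3 (triangle-cycle G x~y y~z x~z))

order-girth-4 : ∀ N q {δ} → 1 ≤ δ → N * 4 ≡ q * Moore δ 4 → N * 2 ≡ q * δ
order-girth-4 N q {δ} 1≤δ order = *-cancelʳ-≡ (N * 2) (q * δ) 2 (begin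
  N * 2 * 2      ≡⟨ *-assoc N 2 2 ⟩
  N * 4          ≡⟨ order ⟩
  q * Moore δ 4  ≡⟨ cong (q *_) (trans (Moore-girth-4 1≤δ) (*-comm 2 δ)) ⟩
  q * (δ * 2)    ≡⟨ *-assoc q δ 2 ⟨
  q * δ * 2      ∎)
  where open ≡-Reasoning

module Layering
  (G : Graph) {δ q : ℕ} .{{_ : NonZero q}} (q>9 : 9 < q) (regular : Regular G δ)
  (triangle-free : TriangleFree G) (C : Cycle G q) (isometric : Isometric G C)
  (order : n G * 2 ≡ q * δ)
  where

  open Cyclic q

  infix 4 _~_
  _~_ : Fin (n G) → Fin (n G) → Set
  u ~ v = adj G u v ≡ true

  ~-sym : ∀ {u v} → u ~ v → v ~ u
  ~-sym {u} {v} u~v = trans (adj-sym G v u) u~v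

  c : Fin q → Fin (n G)
  c = vert C

  cycle-edge : ∀ {i j} → j ≡ i ⊕ 1 → c i ~ c j
  cycle-edge {i} j≡i⊕1 = edges C i _ (⊕1⇒CycSucc j≡i⊕1)

  walk-offset : ∀ {i j d} → Walk G (c i) (c j) d → ∃ λ t → t ≤ d × (j ≡ i ⊕ t ⊎ i ≡ j ⊕ t)
  walk-offset {i} {j} {d} w = cycDist-offset i j (proj₂ (isometric i j) d w)

  small<q : ∀ {t} → t ≤ 9 → t < q
  small<q t≤9 = ≤-<-trans t≤9 q>9

  2≤q : 2 ≤ q
  2≤q = <⇒≤ (small<q (≤ᵇ⇒≤ 2 9 _))

  two-apart : ∀ {v a b} → v ~ c a → v ~ c b → a ≢ b → b ≡ a ⊕ 2 ⊎ a ≡ b ⊕ 2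
  two-apart {v} {a} {b} v~a v~b a≢b with walk-offset (cons (~-sym v~a) (cons v~b nil))
  ... | 0 , _ , inj₁ b≡a⊕0 = ⊥-elim (a≢b (sym (trans b≡a⊕0 (⊕-identityʳ a))))
  ... | 0 , _ , inj₂ a≡b⊕0 = ⊥-elim (a≢b (trans a≡b⊕0 (⊕-identityʳ b)))
  ... | 1 , _ , inj₁ b≡a⊕1 = ⊥-elim (triangle-free v~a (cycle-edge b≡a⊕1) v~b)
  ... | 1 , _ , inj₂ a≡b⊕1 = ⊥-elim (triangle-free v~b (cycle-edge a≡b⊕1) v~a)
  ... | 2 , _ , offset-2 = offset-2
  ... | suc (suc (suc _)) , s≤s (s≤s ()) , _

  no-third : ∀ {v a j} → v ~ c a → v ~ c (a ⊕ 2) → v ~ c j → j ≡ a ⊎ j ≡ a ⊕ 2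
  no-third {v} {a} {j} v~a v~a⊕2 v~j with j ≟ a | j ≟ a ⊕ 2
  ... | yes j≡a | _         = inj₁ j≡a
  ... | no _    | yes j≡a⊕2 = inj₂ j≡a⊕2
  ... | no j≢a  | no j≢a⊕2
    with two-apart v~a v~j (j≢a ∘ sym) | two-apart v~a⊕2 v~j (j≢a⊕2 ∘ sym)
  ...  | inj₁ j≡a⊕2 | _               = ⊥-elim (j≢a⊕2 j≡a⊕2)
  ...  | _          | inj₂ a⊕2≡j⊕2    = ⊥-elim (j≢a (⊕-cancelʳ 2≤q (sym a⊕2≡j⊕2)))
  ...  | inj₂ a≡j⊕2 | inj₁ j≡a⊕2⊕2 = ⊥-elim (⊕-aperiodic (s≤s z≤n) (small<q (≤ᵇ⇒≤ 6 9 _)) (begin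
    a ⊕ 6          ≡⟨ ⊕-assoc a 2 4 ⟨
    a ⊕ 2 ⊕ 4      ≡⟨ ⊕-assoc (a ⊕ 2) 2 2 ⟨
    a ⊕ 2 ⊕ 2 ⊕ 2  ≡⟨ cong (_⊕ 2) j≡a⊕2⊕2 ⟨
    j ⊕ 2          ≡⟨ a≡j⊕2 ⟨
    a              ∎))
    where open ≡-Reasoning

  record CycleNeighbours (v : Fin (n G)) (a : Fin q) : Set where
    field
      lower : v ~ c a
      upper : v ~ c (a ⊕ 2)
      only  : ∀ {j} → v ~ c j → j ≡ a ⊎ j ≡ a ⊕ 2

  pair⇒cycleNeighbours : ∀ {v a b} → v ~ c a → v ~ c b → a ≢ b → ∃ (CycleNeighbours v)
  pair⇒cycleNeighbours {a = a} {b} v~a v~b a≢b with two-apart v~a v~b a≢b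
  ... | inj₁ refl = a , record { lower = v~a ; upper = v~b ; only = no-third v~a v~b }
  ... | inj₂ refl = b , record { lower = v~b ; upper = v~a ; only = no-third v~b v~a }

  cycleDegree : Fin (n G) → ℕ
  cycleDegree v = count (λ j → adj G v (c j))

  cycleDegree≤2 : ∀ v → cycleDegree v ≤ 2
  cycleDegree≤2 v with 2 ≤? cycleDegree v
  ... | no  deg≱2 = <⇒≤ (≰⇒> deg≱2)
  ... | yes deg≥2 =
    let a , b , a≢b , v~a , v~b = distinct-pair _ deg≥2
        a′ , nbrs = pair⇒cycleNeighbours v~a v~b a≢b
    in count-⊆-pair _ a′ (a′ ⊕ 2) (λ j → CycleNeighbours.only nbrs)

  ∑-cycleDegree : sum cycleDegree ≡ sum {n G} (λ _ → 2)
  ∑-cycleDegree = begin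
    sum cycleDegree                          ≡⟨ count-∑-comm (λ v j → adj G v (c j)) ⟩
    sum (λ j → count (λ v → adj G v (c j)))  ≡⟨ sum-cong-≗ (λ j → count-cong (λ v → adj-sym G v (c j))) ⟩
    sum (λ j → degree G (c j))               ≡⟨ sum-cong-≗ (regular ∘ c) ⟩
    sum {q} (λ _ → δ)                        ≡⟨ ∑-const q δ ⟩
    q * δ                                    ≡⟨ order ⟨
    n G * 2                                  ≡⟨ ∑-const (n G) 2 ⟨
    sum {n G} (λ _ → 2)                      ∎
    where open ≡-Reasoning

  cycleDegree≡2 : ∀ v → cycleDegree v ≡ 2
  cycleDegree≡2 = ∑-mono-≤-tight cycleDegree≤2 (≤-reflexive (sym ∑-cycleDegree))

  -- Opaque: letting L unfold into the counting argument that produced it makes the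
  -- case analyses on L below (e.g. in L-cycle) intractable for the type checker.
  opaque
    cycleNeighbours : ∀ v → ∃ (CycleNeighbours v)
    cycleNeighbours v =
      let a , b , a≢b , v~a , v~b = distinct-pair _ (≤-reflexive (sym (cycleDegree≡2 v)))
      in pair⇒cycleNeighbours v~a v~b a≢b

  L : Fin (n G) → Fin q
  L v = proj₁ (cycleNeighbours v)

  module Nbr v = CycleNeighbours (proj₂ (cycleNeighbours v))

  L-cycle : ∀ i → L (c (i ⊕ 1)) ≡ i
  L-cycle i with Nbr.only (c (i ⊕ 1)) (~-sym (cycle-edge refl))
               | Nbr.only (c (i ⊕ 1)) (cycle-edge (sym (⊕-assoc i 1 1)))
  ... | inj₁ i≡a   | _            = sym i≡a
  ... | inj₂ _     | inj₂ i⊕2≡a⊕2 = sym (⊕-cancelʳ 2≤q i⊕2≡a⊕2)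
  ... | inj₂ i≡a⊕2 | inj₁ i⊕2≡a   = ⊥-elim (⊕-aperiodic (s≤s z≤n) (small<q (≤ᵇ⇒≤ 4 9 _)) (begin
    a ⊕ 4      ≡⟨ ⊕-assoc a 2 2 ⟨
    a ⊕ 2 ⊕ 2  ≡⟨ cong (_⊕ 2) i≡a⊕2 ⟨
    i ⊕ 2      ≡⟨ i⊕2≡a ⟩
    a          ∎))
    where
    open ≡-Reasoning
    a = L (c (i ⊕ 1))

  no-short-walk : ∀ {a t} → Walk G (c a) (c (a ⊕ (4 + t))) 3 → t ≤ 1 → ⊥
  no-short-walk {a} {t} w t≤1 with walk-offset w
  ... | s , s≤3 , inj₁ a⊕4+t≡a⊕s =
    ⊕-distinct (≤-trans (s≤s s≤3) (m≤m+n 4 t)) (small<q (+-monoʳ-≤ 4 (≤-trans t≤1 (≤ᵇ⇒≤ 1 5 _))))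
      (sym a⊕4+t≡a⊕s)
  ... | s , s≤3 , inj₂ a≡a⊕4+t⊕s =
    ⊕-aperiodic (s≤s z≤n) (small<q (+-mono-≤ (+-monoʳ-≤ 4 t≤1) (≤-trans s≤3 (≤ᵇ⇒≤ 3 4 _))))
      (trans (sym (⊕-assoc a (4 + t) s)) (sym a≡a⊕4+t⊕s))

  no-long-edge : ∀ {u v t} → u ~ v → L v ≡ L u ⊕ (2 + t) → t ≤ 1 → ⊥
  no-long-edge {u} {v} {t} u~v Lv≡Lu⊕2+t =
    no-short-walk (subst (λ j → Walk G (c (L u)) (c j) 3) Lv⊕2≡Lu⊕4+t
                         (cons (~-sym (Nbr.lower u)) (cons u~v (cons (Nbr.upper v) nil))))
    where
    open ≡-Reasoning
    Lv⊕2≡Lu⊕4+t : L v ⊕ 2 ≡ L u ⊕ (4 + t)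
    Lv⊕2≡Lu⊕4+t = begin
      L v ⊕ 2            ≡⟨ cong (_⊕ 2) Lv≡Lu⊕2+t ⟩
      L u ⊕ (2 + t) ⊕ 2  ≡⟨ ⊕-assoc (L u) (2 + t) 2 ⟩
      L u ⊕ (2 + t + 2)  ≡⟨ cong (λ x → L u ⊕ suc (suc x)) (+-comm t 2) ⟩
      L u ⊕ (4 + t)      ∎

  edge-offset≡1 : ∀ {u v t} → u ~ v → L v ≡ L u ⊕ t → t ≤ 3 → L v ≡ L u ⊕ 1
  edge-offset≡1 {u} {v} {zero} u~v Lv≡Lu⊕0 _ = ⊥-elim (triangle-free u~v v~c[Lu] (Nbr.lower u))
    where
    v~c[Lu] : v ~ c (L u)
    v~c[Lu] = subst (λ j → v ~ c j) (trans Lv≡Lu⊕0 (⊕-identityʳ (L u))) (Nbr.lower v)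
  edge-offset≡1 {t = suc zero} _ Lv≡Lu⊕1 _ = Lv≡Lu⊕1
  edge-offset≡1 {t = suc (suc t)} u~v Lv≡Lu⊕2+t (s≤s (s≤s t≤1)) = ⊥-elim (no-long-edge u~v Lv≡Lu⊕2+t t≤1)

  adjacent⇒consecutive : ∀ {u v} → u ~ v → L v ≡ L u ⊕ 1 ⊎ L u ≡ L v ⊕ 1
  adjacent⇒consecutive {u} {v} u~v
    with walk-offset (cons (~-sym (Nbr.lower u)) (cons u~v (cons (Nbr.lower v) nil)))
  ... | _ , t≤3 , inj₁ Lv≡Lu⊕t = inj₁ (edge-offset≡1 u~v Lv≡Lu⊕t t≤3)
  ... | _ , t≤3 , inj₂ Lu≡Lv⊕t = inj₂ (edge-offset≡1 (~-sym u~v) Lu≡Lv⊕t t≤3)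

  layer : Fin q → ℕ
  layer = layerSize G L

  flanking : Fin q → Fin (n G) → Bool
  flanking i w = ⌊ L w ≟ i ⊕ 2 ⌋ ∨ ⌊ L w ≟ i ⌋

  neighbours⊆flanking : ∀ {u i} → L u ≡ i ⊕ 1 → adj G u ⊆ flanking i
  neighbours⊆flanking Lu≡i⊕1 w u~w =
    ⌊⌋-∨-intro (L w ≟ _) (L w ≟ _) (consecutive-around Lu≡i⊕1 (adjacent⇒consecutive u~w))

  count-flanking : ∀ i → count (flanking i) ≤ layer (i ⊕ 2) + layer i
  count-flanking i = count-∨ (λ w → ⌊ L w ≟ i ⊕ 2 ⌋) (λ w → ⌊ L w ≟ i ⌋)

  δ≤flanking-layers : ∀ i → δ ≤ layer (i ⊕ 2) + layer i
  δ≤flanking-layers i = begin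
    δ                        ≡⟨ regular u ⟨
    degree G u               ≤⟨ count-mono (neighbours⊆flanking (L-cycle (i ⊕ 1))) ⟩
    count (flanking i)       ≤⟨ count-flanking i ⟩
    layer (i ⊕ 2) + layer i  ∎
    where
    open ≤-Reasoning
    u = c (i ⊕ 1 ⊕ 1)

  ∑-flanking-layers : sum (λ i → layer (i ⊕ 2) + layer i) ≡ q * δ
  ∑-flanking-layers = begin
    sum (λ i → layer (i ⊕ 2) + layer i)      ≡⟨ ∑-distrib-+ (λ i → layer (i ⊕ 2)) layer ⟩
    sum (λ i → layer (i ⊕ 2)) + sum layer    ≡⟨ cong (_+ sum layer) (∑-rotate layer 2≤q) ⟩
    sum layer + sum layer                    ≡⟨ cong₂ _+_ (∑-count-fibres L) (∑-count-fibres L) ⟩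
    n G + n G                                ≡⟨ cong (n G +_) (+-identityʳ (n G)) ⟨
    2 * n G                                  ≡⟨ *-comm 2 (n G) ⟩
    n G * 2                                  ≡⟨ order ⟩
    q * δ                                    ∎
    where open ≡-Reasoning

  flanking-layers≡δ : ∀ i → layer (i ⊕ 2) + layer i ≡ δ
  flanking-layers≡δ i =
    sym (∑-mono-≤-tight δ≤flanking-layers (≤-reflexive (trans ∑-flanking-layers (sym (∑-const q δ)))) i)

  consecutive⇒adjacent : ∀ {u w} → L w ≡ L u ⊕ 1 ⊎ L u ≡ L w ⊕ 1 → u ~ w
  consecutive⇒adjacent {u} {w} consecutive =
    count-mono-tight (neighbours⊆flanking Lu≡i⊕1) flanking≤degree w
      (⌊⌋-∨-intro (L w ≟ _) (L w ≟ _) (consecutive-around Lu≡i⊕1 consecutive))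
    where
    open ≤-Reasoning
    i = L u ⊕ (q ∸ 1)
    Lu≡i⊕1 : L u ≡ i ⊕ 1
    Lu≡i⊕1 = sym (⊕-∸-inverseˡ (L u) (>-nonZero⁻¹ q))
    flanking≤degree : count (flanking i) ≤ degree G u
    flanking≤degree = begin
      count (flanking i)       ≤⟨ count-flanking i ⟩
      layer (i ⊕ 2) + layer i  ≡⟨ flanking-layers≡δ i ⟩
      δ                        ≡⟨ regular u ⟨
      degree G u               ∎

  adjacent⇔consecutive : ∀ u v → u ~ v ⇔ (CycSucc (L u) (L v) ⊎ CycSucc (L v) (L u))
  adjacent⇔consecutive u v = mk⇔
    (λ u~v → Sum.map ⊕1⇒CycSucc ⊕1⇒CycSucc (adjacent⇒consecutive u~v))
    (λ consecutive → consecutive⇒adjacent (Sum.map CycSucc⇒⊕1 CycSucc⇒⊕1 consecutive))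

  layer-nonempty : ∀ i → 0 < layer i
  layer-nonempty i = count-pos (λ v → ⌊ L v ≟ i ⌋) (⌊⌋-complete (L (c (i ⊕ 1)) ≟ i) (L-cycle i))

  ν : ℕ → ℕ
  ν k = layer (k mod q)

  ν-alternating : ∀ k → ν (k + 2) + ν k ≡ δ
  ν-alternating k = trans (cong (λ i → layer i + ν k) (sym (mod-⊕ k 2))) (flanking-layers≡δ (k mod q))

  ν-periodic : Periodic ν q
  ν-periodic k = cong layer (trans (sym (mod-⊕ k q)) (⊕-q (k mod q)))

  layer≡ν : ∀ i → layer i ≡ ν (toℕ i)
  layer≡ν i = cong layer (sym (toℕ-mod i))

  open Alternating {ν} ν-alternating

  ν-halves : ¬ 4 ∣ q → ∀ k → 2 * ν k ≡ δ
  ν-halves 4∤q = periodic-2⇒halves (periodic-2-unless-4∣ ν-periodic 4∤q)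

  layers-halve : ¬ 4 ∣ q → ∀ i → 2 * layer i ≡ δ
  layers-halve 4∤q i = trans (cong (2 *_) (layer≡ν i)) (ν-halves 4∤q (toℕ i))

  4∣q⊎2∣δ : 4 ∣ q ⊎ 2 ∣ δ
  4∣q⊎2∣δ with 4 ∣? q
  ... | yes 4∣q = inj₁ 4∣q
  ... | no 4∤q  = inj₂ (divides (ν 0) (trans (sym (ν-halves 4∤q 0)) (*-comm 2 (ν 0))))

  layers-mod-4 : ∃ λ (m : Vec ℕ 4) →
    (∀ j → 0 < lookup m j) ×
    (lookup m (# 0) + lookup m (# 2) ≡ δ) × (lookup m (# 1) + lookup m (# 3) ≡ δ) ×
    (∀ i → layer i ≡ lookup m (toℕ i mod 4))
  layers-mod-4 =
    m , m-positive ,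
    trans (+-comm (ν 0) (ν 2)) (ν-alternating 0) , trans (+-comm (ν 1) (ν 3)) (ν-alternating 1) ,
    layer≡m
    where
    m : Vec ℕ 4
    m = tabulate (ν ∘ toℕ)
    m-positive : ∀ j → 0 < lookup m j
    m-positive j = subst (0 <_) (sym (lookup∘tabulate (ν ∘ toℕ) j)) (layer-nonempty _)
    layer≡m : ∀ i → layer i ≡ lookup m (toℕ i mod 4)
    layer≡m i = begin
      layer i                 ≡⟨ layer≡ν i ⟩
      ν (toℕ i)               ≡⟨ ν≡ν[%4] (toℕ i) ⟩
      ν (toℕ i % 4)           ≡⟨ cong ν (toℕ-fromℕ< (m%n<n (toℕ i) 4)) ⟨
      ν (toℕ (toℕ i mod 4))   ≡⟨ lookup∘tabulate (ν ∘ toℕ) (toℕ i mod 4) ⟨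
      lookup m (toℕ i mod 4)  ∎
      where open ≡-Reasoning

theorem30 : (G : Graph) (δ q : ℕ) → Regular G δ → Equatorial G δ 4 q →
    ((4 ∣ q) ⊎ (2 ∣ δ)) ×
    ∃ λ (L : Fin (n G) → Fin q) →
      (∀ u v → (adj G u v ≡ true) ⇔ (CycSucc (L u) (L v) ⊎ CycSucc (L v) (L u))) ×
      (4 ∣ q → ∃ λ (m : Vec ℕ 4) →
         (∀ j → 0 < lookup m j) ×
         (lookup m (# 0) + lookup m (# 2) ≡ δ) × (lookup m (# 1) + lookup m (# 3) ≡ δ) ×
         (∀ i → layerSize G L i ≡ lookup m (toℕ i mod 4))) ×
      (¬ (4 ∣ q) → ∀ i → 2 * layerSize G L i ≡ δ)
theorem30 G δ q regular (2≤δ , _ , girth , _ , ((C , isometric) , _) , q>9 , order) =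
  4∣q⊎2∣δ , L , adjacent⇔consecutive , (λ _ → layers-mod-4) , layers-halve
  where
  instance
    q≢0 : NonZero q
    q≢0 = >-nonZero (≤-trans (s≤s z≤n) q>9)
  open Layering G q>9 regular (girth>3⇒triangleFree girth ≤-refl) C isometric
                (order-girth-4 (n G) q (≤-trans (s≤s z≤n) 2≤δ) order)
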